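{- $\chi_{lid}(C_3\times C_3)=\chi_{lid}(C_3\times C_5)=5$.
   Context: $C_n$ denotes the cycle on $n$ vertices. A proper $k$-coloring of a graph $G$ is a map $f:V(G)\to\{1,\dots,k\}$ with $f(u)\neq f(v)$ for every edge $uv$. For a vertex $v$, $N[v]$ denotes its closed neighborhood, and $f(S)=\{f(x):x\in S\}$. A lid-coloring of $G$ is a proper coloring $f$ such that for every edge $uv$ with $N[u]\neq N[v]$ we have $f(N[u])\neq f(N[v])$; $\chi_{lid}(G)$ is the smallest number of colors in a lid-coloring of $G$. The tensor product $G\times H$ has vertex set $V(G)\times V(H)$, where $(u_1,v_1)$ and $(u_2,v_2)$ are adjacent iff $u_1u_2\in E(G)$ and $v_1v_2\in E(H)$. -}

module Defs where

open import Data.Nat using (ℕ; suc; _≤_; NonZero)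
open import Data.Nat.DivMod using (_%_)
open import Data.Fin using (Fin; toℕ)
open import Data.Product using (Σ; _×_; _,_; ∃)
open import Data.Sum using (_⊎_)
open import Relation.Nullary using (¬_)
open import Relation.Binary.PropositionalEquality using (_≡_)
open import Function.Bundles using (_⇔_)

record Graph : Set₁ where
  field
    V   : Set
    Adj : V → V → Set

open Graph public

C : (n : ℕ) → .{{_ : NonZero n}} → Graph
C n = record
  { V   = Fin n
  ; Adj = λ i j → (toℕ j ≡ suc (toℕ i) % n) ⊎ (toℕ i ≡ suc (toℕ j) % n)
  }

_⊗_ : Graph → Graph → Graph
G ⊗ H = record
  { V   = V G × V H
  ; Adj = λ { (u₁ , v₁) (u₂ , v₂) → Adj G u₁ u₂ × Adj H v₁ v₂ }
  }

InN[_] : (G : Graph) → V G → V G → Set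
InN[ G ] v x = (x ≡ v) ⊎ Adj G v x

SameN : (G : Graph) → V G → V G → Set
SameN G u v = ∀ x → InN[ G ] u x ⇔ InN[ G ] v x

InImg : (G : Graph) {k : ℕ} → (V G → Fin k) → V G → Fin k → Set
InImg G f v c = ∃ λ x → InN[ G ] v x × f x ≡ c

SameImg : (G : Graph) {k : ℕ} → (V G → Fin k) → V G → V G → Set
SameImg G f u v = ∀ c → InImg G f u c ⇔ InImg G f v c

IsProperColoring : (G : Graph) {k : ℕ} → (V G → Fin k) → Set
IsProperColoring G f = ∀ u v → Adj G u v → ¬ (f u ≡ f v)

IsLidColoring : (G : Graph) {k : ℕ} → (V G → Fin k) → Set
IsLidColoring G f =
  IsProperColoring G f ×
  (∀ u v → Adj G u v → ¬ SameN G u v → ¬ SameImg G f u v)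

HasLidColoring : Graph → ℕ → Set
HasLidColoring G k = Σ (V G → Fin k) (IsLidColoring G)

χlid≡ : Graph → ℕ → Set
χlid≡ G k = HasLidColoring G k × (∀ m → HasLidColoring G m → k ≤ m)

-- The upper bounds are explicit 5-colourings, verified by deciding the lid condition on a
-- finite graph.  For the lower bounds it suffices to rule out 4 colours, since fewer colours
-- embed injectively into 4.  This is an exhaustive search over partial colourings along a
-- fixed vertex order, pruned by every properness and lid constraint as soon as all the
-- colours it mentions are known.  The search only ever introduces the smallest unused colour
-- as a new colour: a lid-colouring stays one after permuting colours, so a transposition
-- moves any colouring into this canonical form without changing the colours already fixed.
module Submission where

open import Defs
open import Data.Bool using (Bool; true; false; T; _∧_; if_then_else_)
open import Data.Bool.ListAction using (any)
open import Data.Bool.Properties using (T-∧)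
open import Data.Fin using (Fin; toℕ; fromℕ<; inject≤; _↑ʳ_)
open import Data.Fin.Patterns using (0F; 1F; 2F; 3F; 4F)
open import Data.Fin.Permutation.Components using (transpose; transpose-inverse)
open import Data.Fin.Properties as Fin using (inject≤-injective; toℕ-fromℕ<; toℕ<n)
open import Data.List using (List; []; _∷_; _++_; allFin; map; concatMap; upTo; filter; cartesianProduct)
open import Data.List.Membership.Propositional using (_∈_)
open import Data.List.Membership.Propositional.Properties using (∈-allFin; ∈-map⁺; ∈-map⁻; ∈-filter⁺; ∈-filter⁻; ∈-cartesianProduct⁺; ∈-cartesianProduct⁻)
open import Data.List.Relation.Unary.All as All using (All; []; _∷_)
open import Data.List.Relation.Unary.Any as Any using (Any; here; there)
open import Data.List.Relation.Unary.Any.Properties using (any⁺)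
open import Data.Maybe using (Maybe; just; nothing)
open import Data.Maybe.Properties using (just-injective)
open import Data.Nat as ℕ using (ℕ; suc; _≤_; _<_; _≤ᵇ_; _⊔_; _≤?_; NonZero; s≤s⁻¹)
open import Data.Nat.DivMod using (_%_; _mod_)
open import Data.Nat.Properties using (≤⇒≤ᵇ; ≮⇒≥; ≰⇒>; ≤-reflexive; <-trans; <-≤-trans; <-irrefl; m≤m⊔n; m≤n⊔m)
open import Data.Product using (∃; ∃₂; _×_; _,_; proj₂; uncurry)
open import Data.Product.Properties using (≡-dec)
open import Data.Sum using (inj₁; inj₂)
open import Function using (_∘_)
open import Function.Bundles using (_⇔_; mk⇔; Equivalence)
open import Function.Definitions using (Injective)
open import Function.Properties.Equivalence using () renaming (sym to ⇔-sym)
open import Relation.Binary.Definitions using (Decidable; DecidableEquality)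
open import Relation.Binary.PropositionalEquality using (_≡_; _≢_; refl; sym; trans; cong; cong₂; subst)
open import Relation.Nullary using (¬_; Dec; yes; no; does; ¬?)
open import Relation.Nullary.Decidable using (map′; _×-dec_; _⊎-dec_; _→-dec_; toWitness; fromWitnessFalse; isNo; True; dec-true; dec-false)

private variable
  G H : Graph
  m k : ℕ

IsLidColoring-∘-injective : {f : V G → Fin m} {π : Fin m → Fin k} →
  Injective _≡_ _≡_ π → IsLidColoring G f → IsLidColoring G (π ∘ f)
IsLidColoring-∘-injective {G} {f = f} {π} π-inj (proper , lid) =
  (λ u v a → proper u v a ∘ π-inj) ,
  (λ u v a ¬same same → lid u v a ¬same λ c → mk⇔ (pull same c) (pull (⇔-sym ∘ same) c))
  where
  pull : ∀ {u v} → SameImg G (π ∘ f) u v → ∀ c → InImg G f u c → InImg G f v c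
  pull same c (x , x∈N[u] , fx≡c) with Equivalence.to (same (π c)) (x , x∈N[u] , cong π fx≡c)
  ... | y , y∈N[v] , πfy≡πc = y , y∈N[v] , π-inj πfy≡πc

HasLidColoring-mono : m ≤ k → HasLidColoring G m → HasLidColoring G k
HasLidColoring-mono m≤k (f , lid) =
  (λ x → inject≤ (f x) m≤k) , IsLidColoring-∘-injective (inject≤-injective m≤k m≤k _ _) lid

χlid≡-suc : HasLidColoring G (suc k) → ¬ HasLidColoring G k → χlid≡ G (suc k)
χlid≡-suc has ¬has = has , λ m hasₘ → ≮⇒≥ λ m<1+k → ¬has (HasLidColoring-mono (s≤s⁻¹ m<1+k) hasₘ)

_⇔-dec_ : {A B : Set} → Dec A → Dec B → Dec (A ⇔ B)
a? ⇔-dec b? = map′ (uncurry mk⇔) (λ e → Equivalence.to e , Equivalence.from e) ((a? →-dec b?) ×-dec (b? →-dec a?))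

transpose-matchˡ : (i j : Fin k) → transpose i j i ≡ j
transpose-matchˡ i j rewrite dec-true (i Fin.≟ i) refl = refl

transpose-other : (i j : Fin k) {x : Fin k} → x ≢ i → x ≢ j → transpose i j x ≡ x
transpose-other i j {x} x≢i x≢j rewrite dec-false (x Fin.≟ i) x≢i | dec-false (x Fin.≟ j) x≢j = refl

transpose-injective : (i j : Fin k) → Injective _≡_ _≡_ (transpose i j)
transpose-injective i j eq =
  trans (sym (transpose-inverse j i)) (trans (cong (transpose j i) eq) (transpose-inverse j i))

record FiniteGraph (G : Graph) : Set where
  field
    vertices      : List (V G)
    ∈-vertices    : ∀ x → x ∈ vertices
    _≟_           : DecidableEquality (V G)
    adj?          : Decidable (Adj G)
    neighbours    : V G → List (V G)
    ∈-neighbours  : ∀ {u x} → Adj G u x → x ∈ neighbours u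
    ∈-neighbours⁻ : ∀ {u x} → x ∈ neighbours u → Adj G u x

C-finite : ∀ n .{{_ : NonZero n}} → FiniteGraph (C n)
C-finite n = record
  { vertices      = allFin n
  ; ∈-vertices    = ∈-allFin
  ; _≟_           = Fin._≟_
  ; adj?          = adj?
  ; neighbours    = λ i → filter (adj? i) (allFin n)
  ; ∈-neighbours  = ∈-filter⁺ (adj? _) (∈-allFin _)
  ; ∈-neighbours⁻ = proj₂ ∘ ∈-filter⁻ (adj? _) {xs = allFin n}
  }
  where
  adj? : Decidable (Adj (C n))
  adj? i j = (toℕ j ℕ.≟ suc (toℕ i) % n) ⊎-dec (toℕ i ℕ.≟ suc (toℕ j) % n)

⊗-finite : FiniteGraph G → FiniteGraph H → FiniteGraph (G ⊗ H)
⊗-finite finG finH = record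
  { vertices      = cartesianProduct (vertices finG) (vertices finH)
  ; ∈-vertices    = λ (x , y) → ∈-cartesianProduct⁺ (∈-vertices finG x) (∈-vertices finH y)
  ; _≟_           = ≡-dec (_≟_ finG) (_≟_ finH)
  ; adj?          = λ (x₁ , y₁) (x₂ , y₂) → adj? finG x₁ x₂ ×-dec adj? finH y₁ y₂
  ; neighbours    = λ (x , y) → cartesianProduct (neighbours finG x) (neighbours finH y)
  ; ∈-neighbours  = λ (a , b) → ∈-cartesianProduct⁺ (∈-neighbours finG a) (∈-neighbours finH b)
  ; ∈-neighbours⁻ = λ {(x , y)} m → let (a , b) = ∈-cartesianProduct⁻ (neighbours finG x) (neighbours finH y) m
                                   in ∈-neighbours⁻ finG a , ∈-neighbours⁻ finH b
  }
  where open FiniteGraph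

module Decide {G : Graph} (finite : FiniteGraph G) where
  open FiniteGraph finite
  open import Data.List.Membership.DecPropositional _≟_ using (_∈?_)

  ∀-vertex? : {P : V G → Set} → (∀ x → Dec (P x)) → Dec (∀ x → P x)
  ∀-vertex? P? = map′ (λ all x → All.lookup all (∈-vertices x)) (λ all → All.tabulate λ {x} _ → all x)
                      (All.all? P? vertices)

  ∃-vertex? : {P : V G → Set} → (∀ x → Dec (P x)) → Dec (∃ P)
  ∃-vertex? P? = map′ Any.satisfied (λ (x , px) → Any.map (λ { refl → px }) (∈-vertices x))
                      (Any.any? P? vertices)

  InN? : ∀ u x → Dec (InN[ G ] u x)
  InN? u x = (x ≟ u) ⊎-dec adj? u x

  SameN? : ∀ u v → Dec (SameN G u v)
  SameN? u v = ∀-vertex? λ x → InN? u x ⇔-dec InN? v x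

  SameImg? : (f : V G → Fin k) → ∀ u v → Dec (SameImg G f u v)
  SameImg? f u v = Fin.all? λ c → InImg? u c ⇔-dec InImg? v c
    where
    InImg? : ∀ w c → Dec (InImg G f w c)
    InImg? w c = ∃-vertex? λ x → InN? w x ×-dec (f x Fin.≟ c)

  isLidColoring? : (f : V G → Fin k) → Dec (IsLidColoring G f)
  isLidColoring? f =
    (∀-vertex? λ u → ∀-vertex? λ v → adj? u v →-dec ¬? (f u Fin.≟ f v)) ×-dec
    (∀-vertex? λ u → ∀-vertex? λ v → adj? u v →-dec ¬? (SameN? u v) →-dec ¬? (SameImg? f u v))

  N[_] : V G → List (V G)
  N[ u ] = u ∷ neighbours u

  ∈-N[_] : ∀ u {x} → InN[ G ] u x → x ∈ N[ u ]
  ∈-N[ u ] (inj₁ refl) = here refl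
  ∈-N[ u ] (inj₂ a)    = there (∈-neighbours a)

  ∈-N[_]⁻ : ∀ u {x} → x ∈ N[ u ] → InN[ G ] u x
  ∈-N[ u ]⁻ (here refl) = inj₁ refl
  ∈-N[ u ]⁻ (there m)   = inj₂ (∈-neighbours⁻ m)

  InImg⇔∈-map : ∀ {g : V G → Fin k} {u c} → InImg G g u c ⇔ c ∈ map g N[ u ]
  InImg⇔∈-map {g = g} {u} = mk⇔
    (λ (x , x∈N[u] , gx≡c) → subst (_∈ _) gx≡c (∈-map⁺ g (∈-N[ u ] x∈N[u])))
    (λ c∈ → let (x , x∈N[u] , c≡gx) = ∈-map⁻ g c∈ in x , ∈-N[ u ]⁻ x∈N[u] , sym c≡gx)

  data Constraint : Set where
    colours-differ colour-sets-differ : V G → V G → Constraint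

  Schedule : Set
  Schedule = List (V G × List Constraint)

  -- Pairs each vertex of the order with the constraints that become decidable once it is
  -- coloured.  The search is sound for every schedule; this one merely prunes as early as possible.
  schedule : List (V G) → Schedule
  schedule = go []
    where
    go : List (V G) → List (V G) → Schedule
    go coloured []       = []
    go coloured (v ∷ vs) = (v , colourConstraints ++ colourSetConstraints) ∷ go (v ∷ coloured) vs
      where
      colourConstraints : List Constraint
      colourConstraints = map (colours-differ v) (filter (_∈? coloured) (neighbours v))

      completed? : ∀ u w → Dec (All (_∈ v ∷ coloured) (N[ u ] ++ N[ w ]))
      completed? u w = All.all? (_∈? v ∷ coloured) (N[ u ] ++ N[ w ])

      colourSetConstraints : List Constraint
      colourSetConstraints =
        concatMap (λ u → map (colour-sets-differ u) (filter (completed? u) (neighbours u))) N[ v ]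

  module Search (k : ℕ) where
    open import Data.List.Relation.Binary.Subset.DecPropositional (Fin._≟_ {k}) using (_⊆_; _⊆?_)

    private variable
      g : V G → Fin k
      u v w x : V G
      c : Fin k
      cs : List (Fin k)
      xs : List (V G)
      j : ℕ

    Assignment : Set
    Assignment = List (V G × Fin k)

    private variable
      p : Assignment

    colourOf : Assignment → V G → Maybe (Fin k)
    colourOf []            x = nothing
    colourOf ((y , c) ∷ p) x = if does (x ≟ y) then just c else colourOf p x

    colours : Assignment → List (V G) → Maybe (List (Fin k))
    colours p []       = just []
    colours p (x ∷ xs) with colourOf p x | colours p xs
    ... | just c | just cs = just (c ∷ cs)
    ... | _      | _       = nothing

    Agrees : (V G → Fin k) → Assignment → Set
    Agrees g = All λ (x , c) → g x ≡ c

    UsedBelow : Assignment → ℕ → Set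
    UsedBelow p j = All (λ (_ , c) → toℕ c < j) p

    colourOf-agrees : Agrees g p → colourOf p x ≡ just c → g x ≡ c
    colourOf-agrees {p = (y , d) ∷ p} {x} (gy≡d ∷ agrees) eq with x ≟ y
    ... | yes refl = trans gy≡d (just-injective eq)
    ... | no _     = colourOf-agrees agrees eq

    colours-agrees : Agrees g p → colours p xs ≡ just cs → map g xs ≡ cs
    colours-agrees {xs = []} agrees refl = refl
    colours-agrees {p = p} {xs = x ∷ xs} agrees eq
      with colourOf p x in eqₓ | colours p xs in eqₓₛ
    colours-agrees agrees refl | just c | just cs =
      cong₂ _∷_ (colourOf-agrees agrees eqₓ) (colours-agrees agrees eqₓₛ)

    SameColour : Assignment → V G → V G → Set
    SameColour p u w = ∃ λ c → colourOf p u ≡ just c × colourOf p w ≡ just c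

    sameColour? : ∀ p u w → Dec (SameColour p u w)
    sameColour? p u w with colourOf p u | colourOf p w
    ... | just a  | just b  = map′ (λ { refl → a , refl , refl }) (λ { (_ , refl , refl) → refl }) (a Fin.≟ b)
    ... | nothing | _       = no λ { (_ , () , _) }
    ... | just _  | nothing = no λ { (_ , _ , ()) }

    SameColour-agrees : Agrees g p → SameColour p u w → g u ≡ g w
    SameColour-agrees agrees (_ , pu , pw) = trans (colourOf-agrees agrees pu) (sym (colourOf-agrees agrees pw))

    SameColourSet : Assignment → V G → V G → Set
    SameColourSet p u w = ∃₂ λ cs ds → colours p N[ u ] ≡ just cs × colours p N[ w ] ≡ just ds × cs ⊆ ds × ds ⊆ cs

    sameColourSet? : ∀ p u w → Dec (SameColourSet p u w)
    sameColourSet? p u w with colours p N[ u ] | colours p N[ w ]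
    ... | just cs | just ds = map′ (λ (cs⊆ds , ds⊆cs) → cs , ds , refl , refl , cs⊆ds , ds⊆cs)
                                   (λ { (_ , _ , refl , refl , ⊆s) → ⊆s }) (cs ⊆? ds ×-dec ds ⊆? cs)
    ... | nothing | _       = no λ { (_ , _ , () , _) }
    ... | just _  | nothing = no λ { (_ , _ , _ , () , _) }

    colours-InImg : Agrees g p → colours p N[ u ] ≡ just cs → InImg G g u c ⇔ c ∈ cs
    colours-InImg {g = g} {u = u} {c = c} agrees eq =
      subst (λ cs → InImg G g u c ⇔ c ∈ cs) (colours-agrees agrees eq) InImg⇔∈-map

    SameColourSet-agrees : Agrees g p → SameColourSet p u w → SameImg G g u w
    SameColourSet-agrees agrees (_ , _ , pu , pw , cs⊆ds , ds⊆cs) c = mk⇔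
      (from (colours-InImg agrees pw) ∘ cs⊆ds ∘ to (colours-InImg agrees pu))
      (from (colours-InImg agrees pu) ∘ ds⊆cs ∘ to (colours-InImg agrees pw))
      where open Equivalence

    Violated : Assignment → Constraint → Set
    Violated p (colours-differ u w)     = Adj G u w × SameColour p u w
    Violated p (colour-sets-differ u w) = Adj G u w × SameColourSet p u w × ¬ SameN G u w

    violated? : ∀ p c → Dec (Violated p c)
    violated? p (colours-differ u w)     = adj? u w ×-dec sameColour? p u w
    violated? p (colour-sets-differ u w) = adj? u w ×-dec sameColourSet? p u w ×-dec ¬? (SameN? u w)

    IsLidColoring⇒¬Violated : IsLidColoring G g → Agrees g p → ∀ c → ¬ Violated p c
    IsLidColoring⇒¬Violated (proper , _) agrees (colours-differ u w) (a , same) =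
      proper u w a (SameColour-agrees agrees same)
    IsLidColoring⇒¬Violated (_ , lid) agrees (colour-sets-differ u w) (a , same , ¬sameN) =
      lid u w a ¬sameN (SameColourSet-agrees agrees same)

    -- The colours used so far are below j, and a new colour may exceed them by at most one:
    -- by canonicalise, every lid-colouring can be brought into this form.
    extensible : Schedule → Assignment → ℕ → Bool
    extensible []              p j = true
    extensible ((v , cs) ∷ s) p j = any admissible (allFin k)
      where
      admissible : Fin k → Bool
      admissible c = (toℕ c ≤ᵇ j) ∧ isNo (Any.any? (violated? ((v , c) ∷ p)) cs)
                   ∧ extensible s ((v , c) ∷ p) (j ⊔ suc (toℕ c))

    UsedBelow-∷ : UsedBelow p j → UsedBelow ((v , c) ∷ p) (j ⊔ suc (toℕ c))
    UsedBelow-∷ {j = j} below = m≤n⊔m j _ ∷ All.map (λ c<j → <-≤-trans c<j (m≤m⊔n j _)) below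

    Agrees-transpose : Agrees g p → UsedBelow p j → j < toℕ (g v) → (ĵ : Fin k) → toℕ ĵ ≡ j →
                       Agrees (transpose (g v) ĵ ∘ g) p
    Agrees-transpose {g} {v = v} agrees below j<gv ĵ ĵ≡j = All.zipWith fixed (agrees , below)
      where
      fixed : ∀ {(x , c) : V G × Fin k} → g x ≡ c × toℕ c < _ → transpose (g v) ĵ (g x) ≡ c
      fixed (refl , c<j) = transpose-other (g v) ĵ
        (λ e → <-irrefl refl (<-trans c<j (subst (λ d → _ < toℕ d) (sym e) j<gv)))
        (λ e → <-irrefl (trans (cong toℕ e) ĵ≡j) c<j)

    canonicalise : IsLidColoring G g → Agrees g p → UsedBelow p j → ∀ v →
                   ∃ λ g′ → IsLidColoring G g′ × Agrees g′ p × toℕ (g′ v) ≤ j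
    canonicalise {g} {j = j} lid agrees below v with toℕ (g v) ≤? j
    ... | yes gv≤j = g , lid , agrees , gv≤j
    ... | no  gv≰j =
      transpose (g v) ĵ ∘ g ,
      IsLidColoring-∘-injective (transpose-injective (g v) ĵ) lid ,
      Agrees-transpose agrees below j<gv ĵ ĵ≡j ,
      ≤-reflexive (trans (cong toℕ (transpose-matchˡ (g v) ĵ)) ĵ≡j)
      where
      j<gv : j < toℕ (g v)
      j<gv = ≰⇒> gv≰j
      ĵ : Fin k
      ĵ = fromℕ< (<-trans j<gv (toℕ<n (g v)))
      ĵ≡j : toℕ ĵ ≡ j
      ĵ≡j = toℕ-fromℕ< _

    extensible-complete : ∀ s → IsLidColoring G g → Agrees g p → UsedBelow p j → T (extensible s p j)
    extensible-complete []               _   _      _     = _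
    extensible-complete {p = p} {j = j} ((v , cs) ∷ s) lid agrees below
      with g , lid , agrees , gv≤j ← canonicalise lid agrees below v
      = any⁺ _ (Any.map (λ { refl → admissible }) (∈-allFin (g v)))
      where
      admissible : T ((toℕ (g v) ≤ᵇ j) ∧ isNo (Any.any? (violated? ((v , g v) ∷ p)) cs)
                     ∧ extensible s ((v , g v) ∷ p) (j ⊔ suc (toℕ (g v))))
      admissible = Equivalence.from T-∧
        (≤⇒≤ᵇ gv≤j , Equivalence.from T-∧
          (fromWitnessFalse (uncurry (IsLidColoring⇒¬Violated lid (refl ∷ agrees)) ∘ Any.satisfied) ,
           extensible-complete s lid (refl ∷ agrees) (UsedBelow-∷ below)))

    ¬extensible⇒¬HasLidColoring : ∀ s → extensible s [] 0 ≡ false → ¬ HasLidColoring G k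
    ¬extensible⇒¬HasLidColoring s eq (g , lid) = subst T eq (extensible-complete s lid [] [])

  χlid≡-by-search : (f : V G → Fin (suc k)) (order : List (V G)) → True (isLidColoring? f) →
                    Search.extensible k (schedule order) [] 0 ≡ false → χlid≡ G (suc k)
  χlid≡-by-search {k} f order lid ¬extensible =
    χlid≡-suc (f , toWitness lid) (Search.¬extensible⇒¬HasLidColoring k (schedule order) ¬extensible)

colouring₉ : Fin 3 × Fin 3 → Fin 5
colouring₉ (0F , _) = 0F
colouring₉ (1F , _) = 1F
colouring₉ (2F , b) = 2 ↑ʳ b

colouring₁₅ : Fin 3 × Fin 5 → Fin 5
colouring₁₅ (0F , _)  = 0F
colouring₁₅ (1F , 3F) = 2F
colouring₁₅ (1F , 4F) = 2F
colouring₁₅ (1F , _)  = 1F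
colouring₁₅ (2F , 3F) = 4F
colouring₁₅ (2F , 4F) = 4F
colouring₁₅ (2F , _)  = 3F

-- Every vertex, as x ↦ (x mod 3 , x mod 5) for x < 15; any order is sound, this one keeps
-- the search tree small.
diagonal : List (Fin 3 × Fin 5)
diagonal = map (λ x → x mod 3 , x mod 5) (upTo 15)

lemma22 : χlid≡ (C 3 ⊗ C 3) 5 × χlid≡ (C 3 ⊗ C 5) 5
lemma22 =
  Decide.χlid≡-by-search C₃⊗C₃ colouring₉ (FiniteGraph.vertices C₃⊗C₃) _ refl ,
  Decide.χlid≡-by-search C₃⊗C₅ colouring₁₅ diagonal _ refl
  where
  C₃⊗C₃ : FiniteGraph (C 3 ⊗ C 3)
  C₃⊗C₃ = ⊗-finite (C-finite 3) (C-finite 3)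
  C₃⊗C₅ : FiniteGraph (C 3 ⊗ C 5)
  C₃⊗C₅ = ⊗-finite (C-finite 3) (C-finite 5)
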